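{- Let $a$ be a prime, let $N_1,N_2$ be positive integers, and let $n_1\in\mathrm{epsp}N_1(a)$ and $n_2\in\mathrm{epsp}N_2(a)$ both be Carmichael numbers in class A. Let $b$ be the next prime after $a$ and suppose $\gcd(b,n_1)=\gcd(b,n_2)=1$. If the product $n=n_1n_2$ is a Carmichael number in class A, then $n$ is an Euler pseudoprime to every prime base up to and including (at least) $b$.
   Context: A Carmichael number is a composite integer $n$ with $a^{n-1}\equiv1\pmod n$ for all $a$ coprime to $n$. $\lambda(n)$ is the Carmichael lambda function (smallest positive $\ell$ with $x^\ell\equiv1\pmod n$ for all $x\in\mathbb{Z}_n^*$), which divides $n-1$ for Carmichael $n$; the index is $i(n)=(n-1)/\lambda(n)$, and a Carmichael number is in class A if $i(n)$ is even. An odd composite positive integer $n$ is an Euler pseudoprime to the base $c$ (a positive integer coprime to $n$) if $\left(\frac{c}{n}\right)\equiv c^{(n-1)/2}\pmod n$, where $\left(\frac{c}{n}\right)$ is the Jacobi symbol. An atomic Euler pseudoprime is an Euler pseudoprime that is not a product of other Euler pseudoprimes. For a prime $a$ and positive integer $N$, $\mathrm{epsp}N(a)$ denotes the set of Euler pseudoprimes that are products of $N$ atomic Euler pseudoprimes and that are Euler pseudoprimes to every prime base from $2$ up to and including $a$, but not to the next prime after $a$. -}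

module Defs where

open import Data.Nat as ℕ using (ℕ; zero; suc; _<_; _≤_; _∸_; _^_; _%_; _/_)
open import Data.Nat.Divisibility using (_∣?_)
open import Data.Nat.Coprimality using (Coprime)
open import Data.Nat.Primality using (Prime; Composite)
open import Data.Nat.Primality.Factorisation using (factorise; factors)
open import Data.Integer as ℤ using (ℤ; +_; -[1+_])
import Data.Integer.Divisibility as ℤD
open import Data.List using (List; []; _∷_; length; map; upTo)
open import Data.Bool.ListAction using (any)
open import Data.Nat.ListAction using (product)
import Data.List as List
open import Data.Product using (Σ; ∃; _×_)
open import Data.Bool using (if_then_else_)
open import Relation.Nullary using (¬_)
open import Relation.Nullary.Decidable using (⌊_⌋)
open import Data.List.Relation.Unary.All using (All)
open import Relation.Binary.PropositionalEquality using (_≡_)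

ModEq : ℕ → ℤ → ℤ → Set
ModEq n x y = (+ n) ℤD.∣ (x ℤ.- y)

Odd : ℕ → Set
Odd n = ∃ λ k → n ≡ suc (2 ℕ.* k)

Even : ℕ → Set
Even n = ∃ λ k → n ≡ 2 ℕ.* k

legendre : ℕ → ℕ → ℤ
legendre c zero = + 0
legendre c p@(suc _) =
  if ⌊ p ∣? c ⌋ then + 0
  else (if any (λ x → ⌊ (x ℕ.* x) % p ℕ.≟ c % p ⌋) (upTo p) then + 1 else -[1+ 0 ])

jacobi : ℕ → ℕ → ℤ
jacobi c zero = + 0
jacobi c n@(suc _) = List.foldr ℤ._*_ (+ 1) (map (legendre c) (factors (factorise n)))

EulerPsp : ℕ → ℕ → Set
EulerPsp c n =
  Odd n × Composite n × 0 < c × Coprime c n ×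
  ModEq n (jacobi c n) ((+ c) ℤ.^ ((n ∸ 1) / 2))

EpspUpTo : ℕ → ℕ → Set
EpspUpTo a n = ∀ p → Prime p → p ≤ a → EulerPsp p n

Atomic : ℕ → ℕ → Set
Atomic a n = EpspUpTo a n ×
  ¬ (∃ λ (ms : List ℕ) → 2 ≤ length ms × All (EpspUpTo a) ms × product ms ≡ n)

NextPrime : ℕ → ℕ → Set
NextPrime a b = Prime b × a < b × (∀ p → a < p → p < b → ¬ Prime p)

Epsp : ℕ → ℕ → ℕ → Set
Epsp N a n =
  (∃ λ (ms : List ℕ) → length ms ≡ N × All (Atomic a) ms × product ms ≡ n) ×
  EpspUpTo a n ×
  (∀ b → NextPrime a b → ¬ EulerPsp b n)

Carmichael : ℕ → Set
Carmichael n = Composite n ×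
  (∀ x → Coprime x n → ModEq n ((+ x) ℤ.^ (n ∸ 1)) (+ 1))

IsCarmichaelLambda : ℕ → ℕ → Set
IsCarmichaelLambda n ℓ =
  0 < ℓ ×
  (∀ x → Coprime x n → ModEq n ((+ x) ℤ.^ ℓ) (+ 1)) ×
  (∀ m → 0 < m → (∀ x → Coprime x n → ModEq n ((+ x) ℤ.^ m) (+ 1)) → ℓ ≤ m)

ClassA : ℕ → Set
ClassA n = ∃ λ ℓ → IsCarmichaelLambda n ℓ ×
  (∃ λ i → n ∸ 1 ≡ i ℕ.* ℓ × Even i)

-- For x coprime to a class A Carmichael number n we have x^((n-1)/2) ≡ 1 (mod n), so n is an
-- Euler pseudoprime to the base c exactly when the Jacobi symbol (c/n) is 1; being ±1 and
-- n ≥ 3, it is otherwise -1. For a prime p ≤ a both factors have (p/nᵢ) = 1, and for p = b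
-- both have (b/nᵢ) = -1 since nᵢ is not an Euler pseudoprime to b. Multiplicativity of the
-- Jacobi symbol in n gives (p/n₁n₂) = 1 in either case.
module Submission where

open import Defs
open import Data.Nat using (ℕ; _<_; _≤_; _*_)
open import Data.Nat.Primality using (Prime)
open import Data.Nat.Coprimality using (Coprime)

open import Data.Nat as ℕ using (suc; _∸_; _/_; s≤s)
open import Data.Nat.Properties using (≤-refl; ≤-trans; <⇒≤; <-irrefl; ≰⇒>; m≤n⇒m<n∨m≡n)
open import Data.Nat.DivMod using (m*n/n≡m)
open import Data.Nat.Divisibility using (_∣_; _∣?_; ∣-trans; ∣⇒≤; _∣0)
open import Data.Nat.Coprimality using (coprime-divisor)
open import Data.Nat.Primality using (Composite; composite; prime⇒nonTrivial)
open import Data.Nat.Base using (nonTrivial⇒n>1)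
open import Data.Nat.Primality.Factorisation using (PrimeFactorisation; factorise; factors; factorisationUnique)
open import Data.Nat.ListAction.Properties using (product-++; ∈⇒∣product)
import Data.Nat.Tactic.RingSolver as ℕ-Solver
open import Data.Integer as ℤ using (ℤ; +_; -[1+_])
import Data.Integer.Properties as ℤ
import Data.Integer.Divisibility.Signed as ℤ
open import Data.Integer.Tactic.RingSolver using (solve-∀)
open import Data.List using (List; []; _∷_; _++_; map; foldr)
open import Data.List.Properties using (map-++)
open import Data.List.Relation.Unary.All as All using (All; []; _∷_)
import Data.List.Relation.Unary.All.Properties as All
open import Data.List.Relation.Binary.Permutation.Propositional using (_↭_; ↭⇒↭ₛ)
import Data.List.Relation.Binary.Permutation.Propositional.Properties as ↭
import Data.List.Relation.Binary.Permutation.Setoid.Properties as ↭ₛ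
open import Data.Bool using (true; false; if_then_else_)
open import Data.Product using (_×_; _,_; proj₁; proj₂)
open import Data.Sum using (_⊎_; inj₁; inj₂)
open import Relation.Nullary using (¬_; yes; no; contradiction)
open import Relation.Binary.PropositionalEquality using (_≡_; refl; sym; trans; cong; cong₂; subst; setoid; module ≡-Reasoning)

prime⇒1< : ∀ {p} → Prime p → 1 < p
prime⇒1< {p} p-prime = nonTrivial⇒n>1 p {{prime⇒nonTrivial p-prime}}

odd-* : ∀ {m n} → Odd m → Odd n → Odd (m * n)
odd-* (k , refl) (l , refl) = k ℕ.+ l ℕ.+ 2 ℕ.* k ℕ.* l , expand k l
  where
  expand : ∀ k l → suc (2 ℕ.* k) ℕ.* suc (2 ℕ.* l) ≡ suc (2 ℕ.* (k ℕ.+ l ℕ.+ 2 ℕ.* k ℕ.* l))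
  expand = ℕ-Solver.solve-∀

coprime-* : ∀ {k m n} → Coprime k m → Coprime k n → Coprime k (m * n)
coprime-* k⊥m k⊥n (d∣k , d∣mn) =
  k⊥n (d∣k , coprime-divisor (λ (e∣d , e∣m) → k⊥m (∣-trans e∣d d∣k , e∣m)) d∣mn)

composite⇒3≤ : ∀ {n} → Composite n → 3 ≤ n
composite⇒3≤ (composite {d} d<n _) = ≤-trans (s≤s (nonTrivial⇒n>1 d)) d<n

modEq-sym : ∀ {n x y} → ModEq n x y → ModEq n y x
modEq-sym {n} {x} {y} x≡y = ℤ.∣⇒∣ᵤ (subst ((+ n) ℤ.∣_) (negate-− x y) (ℤ.∣m⇒∣-m (ℤ.∣ᵤ⇒∣ {i = x ℤ.- y} x≡y)))
  where
  negate-− : ∀ x y → ℤ.- (x ℤ.- y) ≡ y ℤ.- x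
  negate-− = solve-∀

modEq-trans : ∀ {n x y z} → ModEq n x y → ModEq n y z → ModEq n x z
modEq-trans {n} {x} {y} {z} x≡y y≡z =
  ℤ.∣⇒∣ᵤ (subst ((+ n) ℤ.∣_) (telescope x y z) (ℤ.∣m∣n⇒∣m+n (ℤ.∣ᵤ⇒∣ {i = x ℤ.- y} x≡y) (ℤ.∣ᵤ⇒∣ {i = y ℤ.- z} y≡z)))
  where
  telescope : ∀ x y z → (x ℤ.- y) ℤ.+ (y ℤ.- z) ≡ x ℤ.- z
  telescope = solve-∀

modEq-^-1 : ∀ {n y} k → ModEq n y (+ 1) → ModEq n (y ℤ.^ k) (+ 1)
modEq-^-1 {n}     ℕ.zero  _   = n ∣0
modEq-^-1 {n} {y} (suc k) y≡1 =
  ℤ.∣⇒∣ᵤ (subst ((+ n) ℤ.∣_) (split y (y ℤ.^ k))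
    (ℤ.∣m∣n⇒∣m+n (ℤ.∣n⇒∣m*n y (ℤ.∣ᵤ⇒∣ {i = y ℤ.^ k ℤ.- + 1} (modEq-^-1 k y≡1))) (ℤ.∣ᵤ⇒∣ {i = y ℤ.- + 1} y≡1)))
  where
  split : ∀ y w → y ℤ.* (w ℤ.- + 1) ℤ.+ (y ℤ.- + 1) ≡ y ℤ.* w ℤ.- + 1
  split = solve-∀

classA⇒^half≡1 : ∀ {n} → ClassA n → ∀ x → Coprime x n →
                 ModEq n ((+ x) ℤ.^ ((n ∸ 1) / 2)) (+ 1)
classA⇒^half≡1 {n} (ℓ , (_ , x^ℓ≡1 , _) , _ , n-1≡iℓ , k , refl) x x⊥n =
  subst (λ e → ModEq n e (+ 1)) (trans (ℤ.^-*-assoc (+ x) ℓ k) (cong ((+ x) ℤ.^_) (sym half≡ℓk)))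
    (modEq-^-1 k (x^ℓ≡1 x x⊥n))
  where
  half≡ℓk : (n ∸ 1) / 2 ≡ ℓ ℕ.* k
  half≡ℓk = begin
    (n ∸ 1) / 2            ≡⟨ cong (_/ 2) n-1≡iℓ ⟩
    2 ℕ.* k ℕ.* ℓ / 2      ≡⟨ cong (_/ 2) (reorder k ℓ) ⟩
    ℓ ℕ.* k ℕ.* 2 / 2      ≡⟨ m*n/n≡m (ℓ ℕ.* k) 2 ⟩
    ℓ ℕ.* k                ∎
    where
    open ≡-Reasoning
    reorder : ∀ k ℓ → 2 ℕ.* k ℕ.* ℓ ≡ ℓ ℕ.* k ℕ.* 2
    reorder = ℕ-Solver.solve-∀

Unit : ℤ → Set
Unit z = z ≡ + 1 ⊎ z ≡ -[1+ 0 ]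

unit-* : ∀ {x y} → Unit x → Unit y → Unit (x ℤ.* y)
unit-* (inj₁ refl) (inj₁ refl) = inj₁ refl
unit-* (inj₁ refl) (inj₂ refl) = inj₂ refl
unit-* (inj₂ refl) (inj₁ refl) = inj₂ refl
unit-* (inj₂ refl) (inj₂ refl) = inj₁ refl

-- -1 ≡ 1 (mod n) would mean n ∣ 2.
unit≡1-mod : ∀ {n j} → 3 ≤ n → Unit j → ModEq n j (+ 1) → j ≡ + 1
unit≡1-mod _   (inj₁ j≡1)  _   = j≡1
unit≡1-mod 3≤n (inj₂ refl) n∣2 = contradiction (≤-trans 3≤n (∣⇒≤ n∣2)) (<-irrefl refl)

productℤ : List ℤ → ℤ
productℤ = foldr ℤ._*_ (+ 1)

productℤ-++ : ∀ xs ys → productℤ (xs ++ ys) ≡ productℤ xs ℤ.* productℤ ys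
productℤ-++ []       ys = sym (ℤ.*-identityˡ (productℤ ys))
productℤ-++ (x ∷ xs) ys = trans (cong (x ℤ.*_) (productℤ-++ xs ys)) (sym (ℤ.*-assoc x (productℤ xs) (productℤ ys)))

productℤ-↭ : ∀ {xs ys} → xs ↭ ys → productℤ xs ≡ productℤ ys
productℤ-↭ xs↭ys = ↭ₛ.foldr-commMonoid (setoid ℤ) ℤ.*-1-isCommutativeMonoid (↭⇒↭ₛ xs↭ys)

productℤ-unit : ∀ {xs} → All Unit xs → Unit (productℤ xs)
productℤ-unit []       = inj₁ refl
productℤ-unit (u ∷ us) = unit-* u (productℤ-unit us)

factorisation-* : ∀ {m n} → PrimeFactorisation m → PrimeFactorisation n → PrimeFactorisation (m * n)
factorisation-* f g = record
  { factors         = factors f ++ factors g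
  ; isFactorisation = trans (cong₂ _*_ (PrimeFactorisation.isFactorisation f) (PrimeFactorisation.isFactorisation g))
                            (sym (product-++ (factors f) (factors g)))
  ; factorsPrime    = All.++⁺ (PrimeFactorisation.factorsPrime f) (PrimeFactorisation.factorsPrime g)
  }

legendre-unit : ∀ c {n q} → Coprime c n → 1 < q → q ∣ n → Unit (legendre c q)
legendre-unit c {q = suc q} c⊥n 1<q q∣n with suc q ∣? c
... | yes q∣c = contradiction (c⊥n (q∣c , q∣n)) (λ q≡1 → <-irrefl (sym q≡1) 1<q)
... | no  _   = if-unit _
  where
  if-unit : ∀ b → Unit (if b then + 1 else -[1+ 0 ])
  if-unit true  = inj₁ refl
  if-unit false = inj₂ refl

jacobi-unit : ∀ c {n} → Odd n → Coprime c n → Unit (jacobi c n)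
jacobi-unit c {n} (_ , refl) c⊥n = productℤ-unit (All.map⁺ (All.tabulate λ {q} q∈f →
  legendre-unit c c⊥n (prime⇒1< (All.lookup (PrimeFactorisation.factorsPrime f) q∈f))
    (subst (q ∣_) (sym (PrimeFactorisation.isFactorisation f)) (∈⇒∣product q∈f))))
  where
  f : PrimeFactorisation n
  f = factorise n

jacobi-* : ∀ c {m n} → Odd m → Odd n → jacobi c (m * n) ≡ jacobi c m ℤ.* jacobi c n
jacobi-* c {m} {n} (_ , refl) (_ , refl) = begin
  productℤ (map (legendre c) (factors (factorise (m * n))))
    ≡⟨ productℤ-↭ (↭.map⁺ (legendre c) (factorisationUnique (factorise (m * n)) (factorisation-* f g))) ⟩
  productℤ (map (legendre c) (factors f ++ factors g))
    ≡⟨ cong productℤ (map-++ (legendre c) (factors f) (factors g)) ⟩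
  productℤ (map (legendre c) (factors f) ++ map (legendre c) (factors g))
    ≡⟨ productℤ-++ (map (legendre c) (factors f)) (map (legendre c) (factors g)) ⟩
  jacobi c m ℤ.* jacobi c n ∎
  where
  open ≡-Reasoning
  f : PrimeFactorisation m
  f = factorise m
  g : PrimeFactorisation n
  g = factorise n

classA-eulerPsp⇒jacobi≡1 : ∀ {c n} → ClassA n → EulerPsp c n → jacobi c n ≡ + 1
classA-eulerPsp⇒jacobi≡1 {c} {n} A (n-odd , n-composite , _ , c⊥n , jacobi≡c^half) =
  unit≡1-mod (composite⇒3≤ n-composite) (jacobi-unit c n-odd c⊥n)
    (modEq-trans {x = jacobi c n} jacobi≡c^half (classA⇒^half≡1 A c c⊥n))

classA-jacobi≡1⇒eulerPsp : ∀ {c n} → ClassA n → Odd n → Composite n → 0 < c → Coprime c n →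
                           jacobi c n ≡ + 1 → EulerPsp c n
classA-jacobi≡1⇒eulerPsp {c} {n} A n-odd n-composite 0<c c⊥n jacobi≡1 =
  n-odd , n-composite , 0<c , c⊥n ,
  subst (λ j → ModEq n j c^half) (sym jacobi≡1) (modEq-sym {x = c^half} (classA⇒^half≡1 A c c⊥n))
  where
  c^half : ℤ
  c^half = (+ c) ℤ.^ ((n ∸ 1) / 2)

classA-¬eulerPsp⇒jacobi≡-1 : ∀ {c n} → ClassA n → Odd n → Composite n → 0 < c → Coprime c n →
                             ¬ EulerPsp c n → jacobi c n ≡ -[1+ 0 ]
classA-¬eulerPsp⇒jacobi≡-1 {c} A n-odd n-composite 0<c c⊥n ¬psp with jacobi-unit c n-odd c⊥n
... | inj₁ jacobi≡1  = contradiction (classA-jacobi≡1⇒eulerPsp A n-odd n-composite 0<c c⊥n jacobi≡1) ¬psp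
... | inj₂ jacobi≡-1 = jacobi≡-1

≤nextPrime : ∀ {a b p} → NextPrime a b → Prime p → p ≤ b → p ≤ a ⊎ p ≡ b
≤nextPrime {a} {p = p} (_ , _ , no-prime-between) p-prime p≤b with p ℕ.≤? a
... | yes p≤a = inj₁ p≤a
... | no  p≰a with m≤n⇒m<n∨m≡n p≤b
...   | inj₁ p<b = contradiction p-prime (no-prime-between p (≰⇒> p≰a) p<b)
...   | inj₂ p≡b = inj₂ p≡b

epsp⇒odd×composite : ∀ {N a n} → Prime a → Epsp N a n → Odd n × Composite n
epsp⇒odd×composite a-prime (_ , psp , _) with psp _ a-prime ≤-refl
... | n-odd , n-composite , _ = n-odd , n-composite

epsp-classA⇒jacobi[next]≡-1 : ∀ {N a b n} → Prime a → Epsp N a n → ClassA n → NextPrime a b → Coprime b n →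
                              jacobi b n ≡ -[1+ 0 ]
epsp-classA⇒jacobi[next]≡-1 a-prime E@(_ , _ , ¬psp[next]) A next@(b-prime , _) b⊥n
  with epsp⇒odd×composite a-prime E
... | n-odd , n-composite =
  classA-¬eulerPsp⇒jacobi≡-1 A n-odd n-composite (<⇒≤ (prime⇒1< b-prime)) b⊥n (¬psp[next] _ next)

eulerPsp⇒coprime : ∀ {c n} → EulerPsp c n → Coprime c n
eulerPsp⇒coprime (_ , _ , _ , c⊥n , _) = c⊥n

mainTheorem6 : (a N₁ N₂ n₁ n₂ b : ℕ) → Prime a → 0 < N₁ → 0 < N₂ →
    Epsp N₁ a n₁ → Epsp N₂ a n₂ →
    Carmichael n₁ → ClassA n₁ → Carmichael n₂ → ClassA n₂ →
    NextPrime a b → Coprime b n₁ → Coprime b n₂ →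
    Carmichael (n₁ * n₂) → ClassA (n₁ * n₂) →
    ∀ p → Prime p → p ≤ b → EulerPsp p (n₁ * n₂)
mainTheorem6 _ _ _ n₁ n₂ _ a-prime _ _ E₁ E₂ _ A₁ _ A₂ next b⊥n₁ b⊥n₂ (n-composite , _) A p p-prime p≤b =
  classA-jacobi≡1⇒eulerPsp A (odd-* odd₁ odd₂) n-composite (<⇒≤ (prime⇒1< p-prime))
    (coprime-* (proj₁ coprime×jacobi) (proj₁ (proj₂ coprime×jacobi)))
    (trans (jacobi-* p odd₁ odd₂) (proj₂ (proj₂ coprime×jacobi)))
  where
  odd₁ : Odd n₁
  odd₁ = proj₁ (epsp⇒odd×composite a-prime E₁)
  odd₂ : Odd n₂
  odd₂ = proj₁ (epsp⇒odd×composite a-prime E₂)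
  coprime×jacobi : Coprime p n₁ × Coprime p n₂ × jacobi p n₁ ℤ.* jacobi p n₂ ≡ + 1
  coprime×jacobi with ≤nextPrime next p-prime p≤b
  ... | inj₁ p≤a = eulerPsp⇒coprime psp₁ , eulerPsp⇒coprime psp₂ ,
                   cong₂ ℤ._*_ (classA-eulerPsp⇒jacobi≡1 A₁ psp₁) (classA-eulerPsp⇒jacobi≡1 A₂ psp₂)
    where
    psp₁ : EulerPsp p n₁
    psp₁ = proj₁ (proj₂ E₁) p p-prime p≤a
    psp₂ : EulerPsp p n₂
    psp₂ = proj₁ (proj₂ E₂) p p-prime p≤a
  ... | inj₂ refl = b⊥n₁ , b⊥n₂ ,
                    cong₂ ℤ._*_ (epsp-classA⇒jacobi[next]≡-1 a-prime E₁ A₁ next b⊥n₁)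
                                (epsp-classA⇒jacobi[next]≡-1 a-prime E₂ A₂ next b⊥n₂)
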